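{- The relation $\sqsubseteq'$ is transitive: for all terms $u_1,u_2,u_3$ in normal form, if $u_1\sqsubseteq'u_2$ and $u_2\sqsubseteq'u_3$ then $u_1\sqsubseteq'u_3$.
   Context: Terms $\mathcal{T}$ ($\mathbb{Z}_\infty=\mathbb{Z}\cup\{\infty\}$, $\infty$ largest, $\infty+n=\infty$): generated by $t ::= \mathtt{x} \mid \mathtt{C}\,t \mid (t_1,\dots,t_n) \mid \overline{\mathtt{C}}\,t \mid \pi_i t \mid t_1+t_2 \mid \mathbf{0} \mid \langle w\rangle t$ ($\mathtt{x}$ a variable, $\mathtt{C}$ a constructor, $n\ge0$, $i\ge1$, $w\in\mathbb{Z}_\infty$; $()$ the empty tuple), quotiented by linearity of every term former (sends $\mathbf{0}$ to $\mathbf{0}$, distributes over $+$) and $+$ associative, commutative, idempotent with neutral $\mathbf{0}$. Reduction: contextual closure of $\overline{\mathtt{C}}\,\mathtt{C}\,t\to t$; $\pi_i(t_1,\dots,t_n)\to t_i$ ($1\le i\le n$); $\langle w\rangle\mathtt{C}\,t\to\langle w+1\rangle t$; $\langle w\rangle(t_1,\dots,t_n)\to\sum_i\langle w+1\rangle t_i$ ($n>0$); $\overline{\mathtt{C}}\langle w\rangle t\to\langle w-1\rangle t$; $\pi_i\langle w\rangle t\to\langle w-1\rangle t$; $\langle w\rangle\langle v\rangle t\to\langle w+v\rangle t$; $\pi_i\mathtt{C}\,t\to\mathbf{0}$; $\pi_i(t_1,\dots,t_n)\to\mathbf{0}$ ($i>n$); $\overline{\mathtt{C}}(t_1,\dots,t_n)\to\mathbf{0}$;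 $\overline{\mathtt{C}}\,\mathtt{D}\,t\to\mathbf{0}$ ($\mathtt{C}\ne\mathtt{D}$); it is strongly normalizing and confluent, $\mathrm{nf}(t)$ the normal form; terms are identified with their normal forms below. A destructor sequence $\vec d$ is $()$ or $d_1\cdots d_k\mathtt{x}$ ($d_j$ some $\overline{\mathtt{C}}$ or $\pi_i$), $|\vec d|=k$; a suffix of $d_1\cdots d_k\mathtt{x}$ is some $d_j\cdots d_k\mathtt{x}$, $1\le j\le k+1$. The relation $\sqsubseteq'$ on terms in normal form is inductively generated by the rules: (1) if $u\sqsubseteq'v$ then $\mathtt{C}\,u\sqsubseteq'\mathtt{C}\,v$; (2) if $u_i\sqsubseteq'v_i$ for $i=1..n$ then $(u_1,\dots,u_n)\sqsubseteq'(v_1,\dots,v_n)$; (3) if $\mathrm{nf}(\langle0\rangle u)\sqsubseteq'\mathrm{nf}(\langle w\rangle v)$ then $u\sqsubseteq'\mathrm{nf}(\langle w\rangle v)$; (4) if for every $i=1..n$ there is $j\in\{1..m\}$ with $\langle w_i\rangle\vec{d_i}\sqsubseteq'\langle w'_j\rangle\vec{b_j}$, then $\sum_{i=1}^n\langle w_i\rangle\vec{d_i}\sqsubseteq'\sum_{j=1}^m\langle w'_j\rangle\vec{b_j}$ (the empty sum being $\mathbf{0}$); (5) if $\vec d$ is a suffix of $\vec b$ and $w'+|\vec d|\le w+|\vec b|$ then $\langle w'\rangle\vec b\sqsubseteq'\langle w\rangle\vec d$; (6) $\vec d\sqsubseteq'\vec d$. -}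

module Defs where

open import Data.Nat as ℕ using (ℕ; zero; suc)
open import Data.Integer as ℤ using (ℤ; +_)
open import Data.List using (List; []; _∷_; map; concatMap; length)
open import Data.List.Membership.Propositional using (_∈_)
open import Data.List.Relation.Unary.All using (All)
open import Data.List.Relation.Unary.Any using (Any)
open import Data.List.Relation.Binary.Pointwise using (Pointwise)
open import Data.Product using (_×_; _,_)

data ℤ∞ : Set where
  fin : ℤ → ℤ∞
  ∞   : ℤ∞

infixl 6 _+∞_
_+∞_ : ℤ∞ → ℤ∞ → ℤ∞
fin a +∞ fin b = fin (a ℤ.+ b)
fin a +∞ ∞     = ∞
∞     +∞ _     = ∞

infix 4 _≤∞_
data _≤∞_ : ℤ∞ → ℤ∞ → Set where
  fin≤fin : ∀ {a b} → a ℤ.≤ b → fin a ≤∞ fin b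
  _≤∞∞    : ∀ w → w ≤∞ ∞

Var : Set
Var = ℕ

Con : Set
Con = ℕ

-- Destructor chains  d₁ ⋯ dₖ x  (k ≥ 0).
-- πd k denotes the projection π_{k+1} (so indices i ≥ 1).
data Chain : Set where
  var : Var → Chain
  C̄d  : Con → Chain → Chain
  πd  : ℕ → Chain → Chain

data DSeq : Set where
  unit  : DSeq
  chain : Chain → DSeq

chainLen : Chain → ℕ
chainLen (var _)  = 0
chainLen (C̄d _ c) = suc (chainLen c)
chainLen (πd _ c) = suc (chainLen c)

∣_∣ : DSeq → ℕ
∣ unit ∣    = 0
∣ chain c ∣ = chainLen c

data ChainSuffix : Chain → Chain → Set where
  here   : ∀ {c} → ChainSuffix c c
  thereC : ∀ {c b} C → ChainSuffix c b → ChainSuffix c (C̄d C b)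
  thereπ : ∀ {c b} i → ChainSuffix c b → ChainSuffix c (πd i b)

data Suffix : DSeq → DSeq → Set where
  unit-suffix  : Suffix unit unit
  chain-suffix : ∀ {c b} → ChainSuffix c b → Suffix (chain c) (chain b)

-- Modulo linearity and ACI of +, every term is a finite set of sum-free,
-- 0-free terms; the normal ones are exactly generated by:
--   s ::= C s | (s₁,…,sₙ) | ⟨w⟩ d⃗ | d₁⋯dₖ x
-- (the bare empty tuple () is  tup []).

data Simple : Set where
  con : Con → Simple → Simple
  tup : List Simple → Simple
  wt  : ℤ∞ → DSeq → Simple
  dst : Chain → Simple

-- A term in normal form: a finite sum (set) of simple normal terms,
-- represented by a list, considered up to _≋_ (same set of elements).
-- The empty list is 𝟎.
NF : Set
NF = List Simple

infix 4 _≋_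
_≋_ : NF → NF → Set
u ≋ v = (∀ {s} → s ∈ u → s ∈ v) × (∀ {s} → s ∈ v → s ∈ u)

dseq : DSeq → Simple
dseq unit      = tup []
dseq (chain c) = dst c

-- C u  (linear: C (Σ sᵢ) = Σ C sᵢ)
conNF : Con → NF → NF
conNF C u = map (con C) u

choices : List NF → List (List Simple)
choices []         = [] ∷ []
choices (u ∷ us)   = concatMap (λ s → map (s ∷_) (choices us)) u

-- (u₁,…,uₙ)  (multilinear)
tupNF : List NF → NF
tupNF us = map tup (choices us)

-- nf (⟨w⟩ s) for s simple normal, and nf (⟨w⟩ u) for u in normal form
mutual
  wtS : ℤ∞ → Simple → NF
  wtS w (con _ s)      = wtS (w +∞ fin (+ 1)) s
  wtS w (tup [])       = wt w unit ∷ []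
  wtS w (tup (s ∷ ss)) = wtL (w +∞ fin (+ 1)) (s ∷ ss)
  wtS w (wt v d)       = wt (w +∞ v) d ∷ []
  wtS w (dst c)        = wt w (chain c) ∷ []

  wtL : ℤ∞ → List Simple → NF
  wtL w []       = []
  wtL w (s ∷ ss) = wtS w s Data.List.++ wtL w ss

nfWt : ℤ∞ → NF → NF
nfWt = wtL

atom : ℤ∞ × DSeq → Simple
atom (w , d) = wt w d

infix 4 _⊑′_
data _⊑′_ : NF → NF → Set where
  -- the relation is on terms modulo the quotient
  resp  : ∀ {u u′ v v′} → u ≋ u′ → v ≋ v′ → u ⊑′ v → u′ ⊑′ v′
  rule1 : ∀ {u v} C → u ⊑′ v → conNF C u ⊑′ conNF C v
  rule2 : ∀ {us vs} → Pointwise _⊑′_ us vs → tupNF us ⊑′ tupNF vs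
  rule3 : ∀ {u v} w → nfWt (fin (+ 0)) u ⊑′ nfWt w v → u ⊑′ nfWt w v
  rule4 : (as bs : List (ℤ∞ × DSeq)) →
          All (λ a → Any (λ b → (atom a ∷ []) ⊑′ (atom b ∷ [])) bs) as →
          map atom as ⊑′ map atom bs
  rule5 : ∀ {d b} w w′ → Suffix d b →
          w′ +∞ fin (+ ∣ d ∣) ≤∞ w +∞ fin (+ ∣ b ∣) →
          (wt w′ b ∷ []) ⊑′ (wt w d ∷ [])
  rule6 : ∀ d → (dseq d ∷ []) ⊑′ (dseq d ∷ [])

-- Write nf(⟨w⟩ u) as a finite set of atoms ⟨wᵢ⟩ d⃗ᵢ, and call u atom-dominated by v (u ⊑ᵃ v) when,
-- for every weight w, each atom of nf(⟨w⟩ u) lies below some atom of nf(⟨w⟩ v) in the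
-- order of rule (5). Every derivation of u ⊑′ v yields atom domination, domination is
-- transitive, and rules (3)–(5) turn domination back into u ⊑′ v whenever v is a sum of
-- atoms. Transitivity then goes by induction on the second derivation: if it ends with
-- rule (3), (4) or (5) its target is a sum of atoms; if it ends with rule (1) or (2),
-- the first derivation is, up to ≋, an instance of the same rule (an empty target forces
-- an empty source, by domination again), which reduces the claim to the components.
module Submission where

open import Defs
open import Data.Integer as ℤ using (+_; -_)
import Data.Integer.Properties as ℤ
open import Data.Integer.Solver using (module +-*-Solver)
open import Data.List using (List; []; _∷_; map; _++_)
open import Data.List.Properties using (map-++; map-cong; map-id)
open import Data.List.Membership.Propositional using (_∈_; find)
open import Data.List.Membership.Propositional.Properties
  using (∉[]; ∈-map⁺; ∈-map⁻; ∈-++⁺ˡ; ∈-++⁺ʳ; ∈-++⁻; ∈-concatMap⁺; ∈-concatMap⁻)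
open import Data.List.Relation.Binary.Subset.Propositional using (_⊆_)
open import Data.List.Relation.Unary.All as All using (All; []; _∷_)
open import Data.List.Relation.Unary.Any as Any using (Any; here; there)
open import Data.List.Relation.Binary.Pointwise as Pointwise using (Pointwise; []; _∷_)
open import Data.Product using (∃; ∃₂; _×_; _,_; proj₁; proj₂)
open import Data.Sum using (_⊎_; inj₁; inj₂)
open import Data.Empty using (⊥-elim)
open import Function using (_∘_)
open import Relation.Binary.PropositionalEquality
  using (_≡_; refl; sym; trans; cong; cong₂; subst; subst₂; module ≡-Reasoning)

0∞ 1∞ : ℤ∞
0∞ = fin (+ 0)
1∞ = fin (+ 1)

+∞-assoc : ∀ x y z → (x +∞ y) +∞ z ≡ x +∞ (y +∞ z)
+∞-assoc (fin a) (fin b) (fin c) = cong fin (ℤ.+-assoc a b c)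
+∞-assoc (fin a) (fin b) ∞       = refl
+∞-assoc (fin a) ∞       z       = refl
+∞-assoc ∞       y       z       = refl

+∞-identityˡ : ∀ x → 0∞ +∞ x ≡ x
+∞-identityˡ (fin a) = cong fin (ℤ.+-identityˡ a)
+∞-identityˡ ∞       = refl

+∞-identityʳ : ∀ x → x +∞ 0∞ ≡ x
+∞-identityʳ (fin a) = cong fin (ℤ.+-identityʳ a)
+∞-identityʳ ∞       = refl

≤∞-refl : ∀ x → x ≤∞ x
≤∞-refl (fin a) = fin≤fin ℤ.≤-refl
≤∞-refl ∞       = ∞ ≤∞∞

+∞-monoʳ-≤∞ : ∀ w {x y} → x ≤∞ y → w +∞ x ≤∞ w +∞ y
+∞-monoʳ-≤∞ (fin a) (fin≤fin b≤c) = fin≤fin (ℤ.+-monoʳ-≤ a b≤c)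
+∞-monoʳ-≤∞ (fin a) (_ ≤∞∞)       = _ ≤∞∞
+∞-monoʳ-≤∞ ∞       _             = ∞ ≤∞∞

+-≤-trans-crossed : ∀ a b c i j k → a ℤ.+ j ℤ.≤ b ℤ.+ i → b ℤ.+ k ℤ.≤ c ℤ.+ j →
                    a ℤ.+ k ℤ.≤ c ℤ.+ i
+-≤-trans-crossed a b c i j k h₁ h₂ = begin
  a ℤ.+ k                                  ≡⟨ shuffleˡ ⟩
  ((a ℤ.+ j) ℤ.+ (b ℤ.+ k)) ℤ.- (b ℤ.+ j)  ≤⟨ ℤ.+-monoˡ-≤ (- (b ℤ.+ j)) (ℤ.+-mono-≤ h₁ h₂) ⟩
  ((b ℤ.+ i) ℤ.+ (c ℤ.+ j)) ℤ.- (b ℤ.+ j)  ≡⟨ shuffleʳ ⟩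
  c ℤ.+ i                                  ∎
  where
  open ℤ.≤-Reasoning
  open +-*-Solver
  shuffleˡ : a ℤ.+ k ≡ ((a ℤ.+ j) ℤ.+ (b ℤ.+ k)) ℤ.- (b ℤ.+ j)
  shuffleˡ = solve 4 (λ a b j k → a :+ k := ((a :+ j) :+ (b :+ k)) :- (b :+ j)) refl a b j k
  shuffleʳ : ((b ℤ.+ i) ℤ.+ (c ℤ.+ j)) ℤ.- (b ℤ.+ j) ≡ c ℤ.+ i
  shuffleʳ = solve 4 (λ b c i j → ((b :+ i) :+ (c :+ j)) :- (b :+ j) := c :+ i) refl b c i j

≤∞-trans-crossed : ∀ x y z i j k → x +∞ fin j ≤∞ y +∞ fin i → y +∞ fin k ≤∞ z +∞ fin j →
                   x +∞ fin k ≤∞ z +∞ fin i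
≤∞-trans-crossed x       y       ∞       i j k _ _ = _ ≤∞∞
≤∞-trans-crossed x       ∞       (fin c) i j k _ ()
≤∞-trans-crossed ∞       (fin b) (fin c) i j k () _
≤∞-trans-crossed (fin a) (fin b) (fin c) i j k (fin≤fin h₁) (fin≤fin h₂) =
  fin≤fin (+-≤-trans-crossed a b c i j k h₁ h₂)

ChainSuffix-trans : ∀ {a b c} → ChainSuffix a b → ChainSuffix b c → ChainSuffix a c
ChainSuffix-trans p here         = p
ChainSuffix-trans p (thereC C q) = thereC C (ChainSuffix-trans p q)
ChainSuffix-trans p (thereπ i q) = thereπ i (ChainSuffix-trans p q)

Suffix-refl : ∀ d → Suffix d d
Suffix-refl unit      = unit-suffix
Suffix-refl (chain c) = chain-suffix here

Suffix-trans : ∀ {a b c} → Suffix a b → Suffix b c → Suffix a c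
Suffix-trans unit-suffix      unit-suffix      = unit-suffix
Suffix-trans (chain-suffix p) (chain-suffix q) = chain-suffix (ChainSuffix-trans p q)

≋-refl : ∀ {u} → u ≋ u
≋-refl = (λ s∈ → s∈) , (λ s∈ → s∈)

≋-sym : ∀ {u v} → u ≋ v → v ≋ u
≋-sym (u⊆v , v⊆u) = v⊆u , u⊆v

≋-trans : ∀ {u v x} → u ≋ v → v ≋ x → u ≋ x
≋-trans (u⊆v , v⊆u) (v⊆x , x⊆v) = v⊆x ∘ u⊆v , v⊆u ∘ x⊆v

≋-empty : ∀ {u v} → u ⊆ [] → v ⊆ [] → u ≋ v
≋-empty u⊆[] v⊆[] = ⊥-elim ∘ ∉[] ∘ u⊆[] , ⊥-elim ∘ ∉[] ∘ v⊆[]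

empty-or-inhabited : ∀ {A : Set} (xs : List A) → xs ⊆ [] ⊎ ∃ λ x → x ∈ xs
empty-or-inhabited []      = inj₁ (λ ())
empty-or-inhabited (x ∷ _) = inj₂ (x , here refl)

Atom : Set
Atom = ℤ∞ × DSeq

infix 4 _≼_ _≪_ _⊑ᵃ_

-- The premise of rule (5): (w′ , b) ≼ (w , d) gives ⟨w′⟩ b ⊑′ ⟨w⟩ d.
_≼_ : Atom → Atom → Set
(w′ , b) ≼ (w , d) = Suffix d b × w′ +∞ fin (+ ∣ d ∣) ≤∞ w +∞ fin (+ ∣ b ∣)

≼-refl : ∀ p → p ≼ p
≼-refl (w , d) = Suffix-refl d , ≤∞-refl _

≼-trans : ∀ {p q r} → p ≼ q → q ≼ r → p ≼ r
≼-trans {x , e} {y , d} {z , c} (d⊑e , h₁) (c⊑d , h₂) =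
  Suffix-trans c⊑d d⊑e , ≤∞-trans-crossed x y z (+ ∣ e ∣) (+ ∣ d ∣) (+ ∣ c ∣) h₁ h₂

shift : ℤ∞ → Atom → Atom
shift w (v , d) = w +∞ v , d

shift-identity : ∀ p → shift 0∞ p ≡ p
shift-identity (v , d) = cong (_, d) (+∞-identityˡ v)

≼-shift : ∀ w {p q} → p ≼ q → shift w p ≼ shift w q
≼-shift w {x , b} {y , d} (d⊑b , h) = d⊑b , subst₂ _≤∞_
  (sym (+∞-assoc w x (fin (+ ∣ d ∣)))) (sym (+∞-assoc w y (fin (+ ∣ b ∣))))
  (+∞-monoʳ-≤∞ w h)

mutual
  atomsS : ℤ∞ → Simple → List Atom
  atomsS w (con _ s)      = atomsS (w +∞ 1∞) s
  atomsS w (tup [])       = (w , unit) ∷ []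
  atomsS w (tup (s ∷ ss)) = atoms (w +∞ 1∞) (s ∷ ss)
  atomsS w (wt v d)       = (w +∞ v , d) ∷ []
  atomsS w (dst c)        = (w , chain c) ∷ []

  atoms : ℤ∞ → NF → List Atom
  atoms w []       = []
  atoms w (s ∷ ss) = atomsS w s ++ atoms w ss

mutual
  map-atom-atomsS : ∀ w s → map atom (atomsS w s) ≡ wtS w s
  map-atom-atomsS w (con _ s)      = map-atom-atomsS (w +∞ 1∞) s
  map-atom-atomsS w (tup [])       = refl
  map-atom-atomsS w (tup (s ∷ ss)) = map-atom-atoms (w +∞ 1∞) (s ∷ ss)
  map-atom-atomsS w (wt v d)       = refl
  map-atom-atomsS w (dst c)        = refl

  map-atom-atoms : ∀ w u → map atom (atoms w u) ≡ nfWt w u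
  map-atom-atoms w []       = refl
  map-atom-atoms w (s ∷ ss) = begin
    map atom (atomsS w s ++ atoms w ss)             ≡⟨ map-++ atom (atomsS w s) (atoms w ss) ⟩
    map atom (atomsS w s) ++ map atom (atoms w ss)
      ≡⟨ cong₂ _++_ (map-atom-atomsS w s) (map-atom-atoms w ss) ⟩
    wtS w s ++ wtL w ss                             ∎
    where open ≡-Reasoning

atoms-conNF : ∀ w C u → atoms w (conNF C u) ≡ atoms (w +∞ 1∞) u
atoms-conNF w C []      = refl
atoms-conNF w C (s ∷ u) = cong (atomsS (w +∞ 1∞) s ++_) (atoms-conNF w C u)

atoms-map-atom : ∀ w ps → atoms w (map atom ps) ≡ map (shift w) ps
atoms-map-atom w []       = refl
atoms-map-atom w (p ∷ ps) = cong (shift w p ∷_) (atoms-map-atom w ps)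

map-shift-identity : ∀ ps → map (shift 0∞) ps ≡ ps
map-shift-identity ps = trans (map-cong shift-identity ps) (map-id ps)

mutual
  atomsS-+∞ : ∀ w w′ s → atomsS (w +∞ w′) s ≡ map (shift w) (atomsS w′ s)
  atomsS-+∞ w w′ (con _ s)      =
    trans (cong (λ x → atomsS x s) (+∞-assoc w w′ _)) (atomsS-+∞ w (w′ +∞ 1∞) s)
  atomsS-+∞ w w′ (tup [])       = refl
  atomsS-+∞ w w′ (tup (s ∷ ss)) =
    trans (cong (λ x → atoms x (s ∷ ss)) (+∞-assoc w w′ _)) (atoms-+∞ w (w′ +∞ 1∞) (s ∷ ss))
  atomsS-+∞ w w′ (wt v d)       = cong (λ x → (x , d) ∷ []) (+∞-assoc w w′ v)
  atomsS-+∞ w w′ (dst c)        = refl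

  atoms-+∞ : ∀ w w′ u → atoms (w +∞ w′) u ≡ map (shift w) (atoms w′ u)
  atoms-+∞ w w′ []       = refl
  atoms-+∞ w w′ (s ∷ ss) = trans (cong₂ _++_ (atomsS-+∞ w w′ s) (atoms-+∞ w w′ ss))
                                 (sym (map-++ (shift w) (atomsS w′ s) (atoms w′ ss)))

atoms-nfWt : ∀ w w′ u → atoms w (nfWt w′ u) ≡ atoms (w +∞ w′) u
atoms-nfWt w w′ u = begin
  atoms w (nfWt w′ u)                 ≡⟨ cong (atoms w) (sym (map-atom-atoms w′ u)) ⟩
  atoms w (map atom (atoms w′ u))     ≡⟨ atoms-map-atom w (atoms w′ u) ⟩
  map (shift w) (atoms w′ u)          ≡⟨ sym (atoms-+∞ w w′ u) ⟩
  atoms (w +∞ w′) u                   ∎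
  where open ≡-Reasoning

nfWt-identity-map-atom : ∀ ps → nfWt 0∞ (map atom ps) ≡ map atom ps
nfWt-identity-map-atom ps = begin
  nfWt 0∞ (map atom ps)                 ≡⟨ sym (map-atom-atoms _ (map atom ps)) ⟩
  map atom (atoms 0∞ (map atom ps))     ≡⟨ cong (map atom) (atoms-map-atom _ ps) ⟩
  map atom (map (shift 0∞) ps)          ≡⟨ cong (map atom) (map-shift-identity ps) ⟩
  map atom ps                                    ∎
  where open ≡-Reasoning

∈-atoms⁻ : ∀ w u {p} → p ∈ atoms w u → ∃ λ s → s ∈ u × p ∈ atomsS w s
∈-atoms⁻ w (s ∷ u) p∈ with ∈-++⁻ (atomsS w s) p∈
... | inj₁ p∈s = s , here refl , p∈s
... | inj₂ p∈u = let t , t∈ , p∈t = ∈-atoms⁻ w u p∈u in t , there t∈ , p∈t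

∈-atoms⁺ : ∀ w {u s p} → s ∈ u → p ∈ atomsS w s → p ∈ atoms w u
∈-atoms⁺ w {s ∷ u} (here refl) p∈ = ∈-++⁺ˡ p∈
∈-atoms⁺ w {s ∷ u} (there s∈)  p∈ = ∈-++⁺ʳ (atomsS w s) (∈-atoms⁺ w s∈ p∈)

∈-map-atom⁻ : ∀ {s} ps → s ∈ map atom ps → ∃₂ λ w d → s ≡ wt w d
∈-map-atom⁻ ps s∈ with ∈-map⁻ atom s∈
... | (w , d) , _ , s≡ = w , d , s≡

∈-nfWt⁻ : ∀ {s} w v → s ∈ nfWt w v → ∃₂ λ w′ d → s ≡ wt w′ d
∈-nfWt⁻ w v = ∈-map-atom⁻ (atoms w v) ∘ subst (_ ∈_) (sym (map-atom-atoms w v))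

atomsS-nonempty : ∀ w s → ∃ λ p → p ∈ atomsS w s
atomsS-nonempty w (con _ s)      = atomsS-nonempty (w +∞ 1∞) s
atomsS-nonempty w (tup [])       = _ , here refl
atomsS-nonempty w (tup (s ∷ ss)) = let p , p∈ = atomsS-nonempty (w +∞ 1∞) s in p , ∈-++⁺ˡ p∈
atomsS-nonempty w (wt v d)       = _ , here refl
atomsS-nonempty w (dst c)        = _ , here refl

∈-choices⁻ : ∀ us {cs} → cs ∈ choices us → Pointwise _∈_ cs us
∈-choices⁻ []       (here refl) = []
∈-choices⁻ (u ∷ us) cs∈ with find (∈-concatMap⁻ (λ s → map (s ∷_) (choices us)) {xs = u} cs∈)
... | s , s∈ , cs∈′ with ∈-map⁻ (s ∷_) cs∈′
... | cs , cs∈″ , refl = s∈ ∷ ∈-choices⁻ us cs∈″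

∈-choices⁺ : ∀ {cs us} → Pointwise _∈_ cs us → cs ∈ choices us
∈-choices⁺ []                          = here refl
∈-choices⁺ {c ∷ cs} {u ∷ us} (c∈ ∷ cs∈) = ∈-concatMap⁺ (λ s → map (s ∷_) (choices us))
  (Any.map (λ { refl → ∈-map⁺ (c ∷_) (∈-choices⁺ cs∈) }) c∈)

∈-tupNF⁻ : ∀ us {s} → s ∈ tupNF us → ∃ λ cs → s ≡ tup cs × Pointwise _∈_ cs us
∈-tupNF⁻ us s∈ with ∈-map⁻ tup s∈
... | cs , cs∈ , refl = cs , refl , ∈-choices⁻ us cs∈

∈-tupNF⁺ : ∀ {cs us} → Pointwise _∈_ cs us → tup cs ∈ tupNF us
∈-tupNF⁺ = ∈-map⁺ tup ∘ ∈-choices⁺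

_≪_ : List Atom → List Atom → Set
ps ≪ qs = ∀ {p} → p ∈ ps → ∃ λ q → q ∈ qs × p ≼ q

≪-trans : ∀ {ps qs rs} → ps ≪ qs → qs ≪ rs → ps ≪ rs
≪-trans ps≪qs qs≪rs p∈ =
  let q , q∈ , p≼q = ps≪qs p∈
      r , r∈ , q≼r = qs≪rs q∈
  in r , r∈ , ≼-trans p≼q q≼r

_⊑ᵃ_ : NF → NF → Set
u ⊑ᵃ v = ∀ w → atoms w u ≪ atoms w v

⊑ᵃ-refl : ∀ {u} → u ⊑ᵃ u
⊑ᵃ-refl w {p} p∈ = p , p∈ , ≼-refl p

⊑ᵃ-trans : ∀ {u v x} → u ⊑ᵃ v → v ⊑ᵃ x → u ⊑ᵃ x
⊑ᵃ-trans u⊑v v⊑x w = ≪-trans (u⊑v w) (v⊑x w)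

atoms-mono-⊆ : ∀ w {u v} → u ⊆ v → atoms w u ⊆ atoms w v
atoms-mono-⊆ w {u} u⊆v p∈ = let s , s∈ , p∈s = ∈-atoms⁻ w u p∈ in ∈-atoms⁺ w (u⊆v s∈) p∈s

⊑ᵃ-resp-≋ : ∀ {u u′ v v′} → u ≋ u′ → v ≋ v′ → u ⊑ᵃ v → u′ ⊑ᵃ v′
⊑ᵃ-resp-≋ (_ , u′⊆u) (v⊆v′ , _) u⊑v w p∈ =
  let q , q∈ , p≼q = u⊑v w (atoms-mono-⊆ w u′⊆u p∈) in q , atoms-mono-⊆ w v⊆v′ q∈ , p≼q

⊑ᵃ-nonempty : ∀ {u v s} → u ⊑ᵃ v → s ∈ u → ∃ λ t → t ∈ v
⊑ᵃ-nonempty {v = v} {s} u⊑v s∈ =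
  let p , p∈ = atomsS-nonempty 0∞ s
      q , q∈ , _ = u⊑v 0∞ (∈-atoms⁺ _ s∈ p∈)
      t , t∈ , _ = ∈-atoms⁻ _ v q∈
  in t , t∈

⊑ᵃ-empty : ∀ {u v} → u ⊑ᵃ v → v ⊆ [] → u ⊆ []
⊑ᵃ-empty u⊑v v⊆[] s∈ = let _ , t∈ = ⊑ᵃ-nonempty u⊑v s∈ in ⊥-elim (∉[] (v⊆[] t∈))

⊑ᵃ-conNF : ∀ C {u v} → u ⊑ᵃ v → conNF C u ⊑ᵃ conNF C v
⊑ᵃ-conNF C {u} {v} u⊑v w rewrite atoms-conNF w C u | atoms-conNF w C v = u⊑v (w +∞ 1∞)

⊑ᵃ-nfWt : ∀ {u v} → nfWt 0∞ u ⊑ᵃ v → u ⊑ᵃ v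
⊑ᵃ-nfWt {u} {v} h w = subst (_≪ atoms w v) atoms-nfWt-identity (h w)
  where
  atoms-nfWt-identity : atoms w (nfWt 0∞ u) ≡ atoms w u
  atoms-nfWt-identity = trans (atoms-nfWt w _ u) (cong (λ x → atoms x u) (+∞-identityʳ w))

⊑ᵃ-map-atom : ∀ {as bs} → All (λ a → Any (a ≼_) bs) as → map atom as ⊑ᵃ map atom bs
⊑ᵃ-map-atom {as} {bs} dom w rewrite atoms-map-atom w as | atoms-map-atom w bs = shifted dom
  where
  shifted : ∀ {as} → All (λ a → Any (a ≼_) bs) as → map (shift w) as ≪ map (shift w) bs
  shifted (a≼bs ∷ _) (here refl) =
    let b , b∈ , a≼b = find a≼bs in shift w b , ∈-map⁺ (shift w) b∈ , ≼-shift w a≼b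
  shifted (_ ∷ dom) (there p∈) = shifted dom p∈

atom-⊑ᵃ⇒≼ : ∀ {a b} → (atom a ∷ []) ⊑ᵃ (atom b ∷ []) → a ≼ b
atom-⊑ᵃ⇒≼ {a} {b} h with h 0∞ (here refl)
... | _ , here refl , a≼b = subst₂ _≼_ (shift-identity a) (shift-identity b) a≼b

choice-exists : ∀ {us vs cs} → Pointwise _⊑ᵃ_ us vs → Pointwise _∈_ cs us →
                ∃ λ ds → Pointwise _∈_ ds vs
choice-exists []            []         = [] , []
choice-exists (u⊑v ∷ us⊑vs) (c∈ ∷ cs∈) =
  let t , t∈ = ⊑ᵃ-nonempty u⊑v c∈
      ds , ds∈ = choice-exists us⊑vs cs∈
  in t ∷ ds , t∈ ∷ ds∈

atoms-choice-dominated : ∀ {us vs cs w p} → Pointwise _⊑ᵃ_ us vs → Pointwise _∈_ cs us →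
  p ∈ atoms w cs → ∃ λ ds → Pointwise _∈_ ds vs × ∃ λ q → q ∈ atoms w ds × p ≼ q
atoms-choice-dominated {cs = c ∷ _} {w} (u⊑v ∷ us⊑vs) (c∈ ∷ cs∈) p∈ with ∈-++⁻ (atomsS w c) p∈
... | inj₁ p∈c =
  let q , q∈v , p≼q = u⊑v w (∈-atoms⁺ w c∈ p∈c)
      t , t∈ , q∈t = ∈-atoms⁻ w _ q∈v
      ds , ds∈ = choice-exists us⊑vs cs∈
  in t ∷ ds , t∈ ∷ ds∈ , q , ∈-++⁺ˡ q∈t , p≼q
... | inj₂ p∈cs =
  let ds , ds∈ , q , q∈ , p≼q = atoms-choice-dominated us⊑vs cs∈ p∈cs
      t , t∈ = ⊑ᵃ-nonempty u⊑v c∈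
  in t ∷ ds , t∈ ∷ ds∈ , q , ∈-++⁺ʳ (atomsS w t) q∈ , p≼q

⊑ᵃ-tupNF : ∀ {us vs} → Pointwise _⊑ᵃ_ us vs → tupNF us ⊑ᵃ tupNF vs
⊑ᵃ-tupNF {us} us⊑vs w p∈ with ∈-atoms⁻ w (tupNF us) p∈
... | s , s∈ , p∈s with ∈-tupNF⁻ us s∈ | us⊑vs
... | [] , refl , [] | [] = _ , p∈ , ≼-refl _
... | _ ∷ _ , refl , cs∈ | us⊑vs′@(_ ∷ _)
  with atoms-choice-dominated us⊑vs′ cs∈ p∈s
... | _ ∷ _ , ds∈ , q , q∈ , p≼q = q , ∈-atoms⁺ w (∈-tupNF⁺ ds∈) q∈ , p≼q

mutual
  ⊑′⇒⊑ᵃ : ∀ {u v} → u ⊑′ v → u ⊑ᵃ v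
  ⊑′⇒⊑ᵃ (resp {u} {u′} {v} {v′} u≋u′ v≋v′ u⊑v) = ⊑ᵃ-resp-≋ {u} {u′} {v} {v′} u≋u′ v≋v′ (⊑′⇒⊑ᵃ u⊑v)
  ⊑′⇒⊑ᵃ (rule1 {u} {v} C u⊑v)                = ⊑ᵃ-conNF C {u} {v} (⊑′⇒⊑ᵃ u⊑v)
  ⊑′⇒⊑ᵃ (rule2 us⊑vs)                        = ⊑ᵃ-tupNF (pointwise-⊑′⇒⊑ᵃ us⊑vs)
  ⊑′⇒⊑ᵃ (rule3 {u} {v} w u⊑v)                = ⊑ᵃ-nfWt {u} {nfWt w v} (⊑′⇒⊑ᵃ u⊑v)
  ⊑′⇒⊑ᵃ (rule4 as bs dom)                    = ⊑ᵃ-map-atom {as} {bs} (all-any-⊑′⇒≼ dom)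
  ⊑′⇒⊑ᵃ (rule5 {d} {b} w w′ d⊑b h)           =
    ⊑ᵃ-map-atom {(w′ , b) ∷ []} {(w , d) ∷ []} (here (d⊑b , h) ∷ [])
  ⊑′⇒⊑ᵃ (rule6 d)                            = ⊑ᵃ-refl {dseq d ∷ []}

  pointwise-⊑′⇒⊑ᵃ : ∀ {us vs} → Pointwise _⊑′_ us vs → Pointwise _⊑ᵃ_ us vs
  pointwise-⊑′⇒⊑ᵃ []            = []
  pointwise-⊑′⇒⊑ᵃ (u⊑v ∷ us⊑vs) = ⊑′⇒⊑ᵃ u⊑v ∷ pointwise-⊑′⇒⊑ᵃ us⊑vs

  all-any-⊑′⇒≼ : ∀ {as bs} → All (λ a → Any (λ b → (atom a ∷ []) ⊑′ (atom b ∷ [])) bs) as →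
                 All (λ a → Any (a ≼_) bs) as
  all-any-⊑′⇒≼ []           = []
  all-any-⊑′⇒≼ (a⊑bs ∷ dom) = any-⊑′⇒≼ a⊑bs ∷ all-any-⊑′⇒≼ dom

  any-⊑′⇒≼ : ∀ {a bs} → Any (λ b → (atom a ∷ []) ⊑′ (atom b ∷ [])) bs → Any (a ≼_) bs
  any-⊑′⇒≼ (here a⊑b)   = here (atom-⊑ᵃ⇒≼ (⊑′⇒⊑ᵃ a⊑b))
  any-⊑′⇒≼ (there a⊑bs) = there (any-⊑′⇒≼ a⊑bs)

≪⇒⊑′-map-atom : ∀ {u ps} → atoms 0∞ u ≪ ps → u ⊑′ map atom ps
≪⇒⊑′-map-atom {u} {ps} u≪ps =
  subst (u ⊑′_) (nfWt-identity-map-atom ps) (rule3 {v = map atom ps} 0∞ premise)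
  where
  atoms⊑′ps : map atom (atoms 0∞ u) ⊑′ map atom ps
  atoms⊑′ps = rule4 _ ps (All.tabulate λ p∈ →
    let q , q∈ , p≼q = u≪ps p∈ in Any.map (λ { refl → rule5 _ _ (proj₁ p≼q) (proj₂ p≼q) }) q∈)
  premise : nfWt 0∞ u ⊑′ nfWt 0∞ (map atom ps)
  premise = subst₂ _⊑′_ (map-atom-atoms _ u) (sym (nfWt-identity-map-atom ps)) atoms⊑′ps

⊑′-trans-map-atom : ∀ {u₁ u₂} ps → u₁ ⊑′ u₂ → u₂ ⊑′ map atom ps → u₁ ⊑′ map atom ps
⊑′-trans-map-atom {u₁} {u₂} ps u₁⊑u₂ u₂⊑ps =
  ≪⇒⊑′-map-atom (subst (atoms 0∞ u₁ ≪_) atoms-ps u₁≪ps)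
  where
  atoms-ps : atoms 0∞ (map atom ps) ≡ ps
  atoms-ps = trans (atoms-map-atom _ ps) (map-shift-identity ps)
  u₁≪ps : atoms 0∞ u₁ ≪ atoms 0∞ (map atom ps)
  u₁≪ps = ⊑ᵃ-trans {u₁} {u₂} {map atom ps} (⊑′⇒⊑ᵃ u₁⊑u₂) (⊑′⇒⊑ᵃ u₂⊑ps) 0∞

⊑′-trans-nfWt : ∀ {u₁ u₂} w v → u₁ ⊑′ u₂ → u₂ ⊑′ nfWt w v → u₁ ⊑′ nfWt w v
⊑′-trans-nfWt {u₁} {u₂} w v u₁⊑u₂ u₂⊑v = subst (u₁ ⊑′_) (map-atom-atoms w v)
  (⊑′-trans-map-atom (atoms w v) u₁⊑u₂ (subst (u₂ ⊑′_) (sym (map-atom-atoms w v)) u₂⊑v))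

conNF-injective : ∀ C {u v} → conNF C u ≋ conNF C v → u ≋ v
conNF-injective C (Cu⊆Cv , Cv⊆Cu) = strip Cu⊆Cv , strip Cv⊆Cu
  where
  strip : ∀ {u v} → conNF C u ⊆ conNF C v → u ⊆ v
  strip Cu⊆Cv s∈ with ∈-map⁻ (con C) (Cu⊆Cv (∈-map⁺ (con C) s∈))
  ... | _ , s∈′ , refl = s∈′

-- The inhabitant c₀ is essential: a product with an empty factor forgets the other factors.
pointwise-≋-from-choices : ∀ {vs xs c₀} →
  (∀ {cs} → Pointwise _∈_ cs vs → Pointwise _∈_ cs xs) →
  (∀ {cs} → Pointwise _∈_ cs xs → Pointwise _∈_ cs vs) →
  Pointwise _∈_ c₀ vs → Pointwise _≋_ vs xs
pointwise-≋-from-choices {[]} to _ [] with to []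
... | [] = []
pointwise-≋-from-choices {_ ∷ _} {[]} to _ c₀∈@(_ ∷ _) with to c₀∈
... | ()
pointwise-≋-from-choices {_ ∷ _} {_ ∷ _} to from (c∈ ∷ c₀∈) with to (c∈ ∷ c₀∈)
... | c∈′ ∷ c₀∈′ =
  ((λ s∈ → Pointwise.head (to (s∈ ∷ c₀∈))) , (λ s∈ → Pointwise.head (from (s∈ ∷ c₀∈′)))) ∷
  pointwise-≋-from-choices (λ cs∈ → Pointwise.tail (to (c∈ ∷ cs∈)))
                           (λ cs∈ → Pointwise.tail (from (c∈′ ∷ cs∈))) c₀∈

tupNF-⊆⇒choices-⊆ : ∀ {vs xs} → tupNF vs ⊆ tupNF xs →
                    ∀ {cs} → Pointwise _∈_ cs vs → Pointwise _∈_ cs xs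
tupNF-⊆⇒choices-⊆ {xs = xs} vs⊆xs cs∈ with ∈-tupNF⁻ xs (vs⊆xs (∈-tupNF⁺ cs∈))
... | _ , refl , cs∈′ = cs∈′

tupNF-injective : ∀ {vs xs t} → tupNF vs ≋ tupNF xs → t ∈ tupNF xs → Pointwise _≋_ vs xs
tupNF-injective {vs} (vs⊆xs , xs⊆vs) t∈ with ∈-tupNF⁻ vs (xs⊆vs t∈)
... | _ , refl , c₀∈ =
  pointwise-≋-from-choices (tupNF-⊆⇒choices-⊆ vs⊆xs) (tupNF-⊆⇒choices-⊆ xs⊆vs) c₀∈

⊑′-conNF⁻ : ∀ C x {u v} → u ⊑′ v → v ≋ conNF C x → ∃ λ z → u ≋ conNF C z × z ⊑′ x
⊑′-conNF⁻ C [] u⊑v (v⊆[] , _) =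
  [] , ≋-empty (⊑ᵃ-empty (⊑′⇒⊑ᵃ u⊑v) v⊆[]) (λ ()) , rule4 [] [] []
⊑′-conNF⁻ C (s ∷ x) (resp u≋u′ v≋v′ u⊑v) v′≋Cx with ⊑′-conNF⁻ C (s ∷ x) u⊑v (≋-trans v≋v′ v′≋Cx)
... | z , u≋Cz , z⊑x = z , ≋-trans (≋-sym u≋u′) u≋Cz , z⊑x
⊑′-conNF⁻ C (s ∷ x) (rule1 {u} C′ u⊑v) v≋Cx with ∈-map⁻ (con C′) (proj₂ v≋Cx (here refl))
... | _ , _ , refl = u , ≋-refl , resp ≋-refl (conNF-injective C v≋Cx) u⊑v
⊑′-conNF⁻ C (s ∷ x) (rule2 _) v≋Cx with ∈-map⁻ tup (proj₂ v≋Cx (here refl))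
... | _ , _ , ()
⊑′-conNF⁻ C (s ∷ x) (rule3 {v = v} w _) v≋Cx with ∈-nfWt⁻ w v (proj₂ v≋Cx (here refl))
... | _ , _ , ()
⊑′-conNF⁻ C (s ∷ x) (rule4 _ bs _) v≋Cx with ∈-map-atom⁻ bs (proj₂ v≋Cx (here refl))
... | _ , _ , ()
⊑′-conNF⁻ C (s ∷ x) (rule5 {d} w _ _ _) v≋Cx
  with ∈-map-atom⁻ ((w , d) ∷ []) (proj₂ v≋Cx (here refl))
... | _ , _ , ()
⊑′-conNF⁻ C (s ∷ x) (rule6 unit) v≋Cx with proj₂ v≋Cx (here refl)
... | here ()
... | there ()
⊑′-conNF⁻ C (s ∷ x) (rule6 (chain _)) v≋Cx with proj₂ v≋Cx (here refl)
... | here ()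
... | there ()

⊑′-tupNF⁻ : ∀ xs {u v t} → u ⊑′ v → v ≋ tupNF xs → t ∈ tupNF xs →
            ∃ λ zs → u ≋ tupNF zs × Pointwise _⊑′_ zs xs
⊑′-tupNF⁻ xs (resp u≋u′ v≋v′ u⊑v) v′≋xs t∈ with ⊑′-tupNF⁻ xs u⊑v (≋-trans v≋v′ v′≋xs) t∈
... | zs , u≋zs , zs⊑xs = zs , ≋-trans (≋-sym u≋u′) u≋zs , zs⊑xs
⊑′-tupNF⁻ xs (rule1 C _) v≋xs t∈ with ∈-tupNF⁻ xs t∈
... | _ , refl , _ with ∈-map⁻ (con C) (proj₂ v≋xs t∈)
... | _ , _ , ()
⊑′-tupNF⁻ xs (rule2 {us} us⊑vs) v≋xs t∈ =
  us , ≋-refl ,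
  Pointwise.transitive (λ u⊑v v≋x → resp ≋-refl v≋x u⊑v) us⊑vs (tupNF-injective v≋xs t∈)
⊑′-tupNF⁻ xs (rule3 {v = v} w _) v≋xs t∈ with ∈-tupNF⁻ xs t∈
... | _ , refl , _ with ∈-nfWt⁻ w v (proj₂ v≋xs t∈)
... | _ , _ , ()
⊑′-tupNF⁻ xs (rule4 _ bs _) v≋xs t∈ with ∈-tupNF⁻ xs t∈
... | _ , refl , _ with ∈-map-atom⁻ bs (proj₂ v≋xs t∈)
... | _ , _ , ()
⊑′-tupNF⁻ xs (rule5 {d} w _ _ _) v≋xs t∈ with ∈-tupNF⁻ xs t∈
... | _ , refl , _ with ∈-map-atom⁻ ((w , d) ∷ []) (proj₂ v≋xs t∈)
... | _ , _ , ()
⊑′-tupNF⁻ xs (rule6 (chain _)) v≋xs t∈ with ∈-tupNF⁻ xs t∈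
... | _ , refl , _ with proj₂ v≋xs t∈
... | here ()
... | there ()
⊑′-tupNF⁻ xs (rule6 unit) v≋xs t∈ with ∈-tupNF⁻ xs t∈
... | _ , refl , cs∈ with proj₂ v≋xs t∈
... | there ()
... | here refl with cs∈
... | [] = [] , ≋-refl , []

mutual
  ⊑′-trans : ∀ {u₁ u₂ u₃} → u₁ ⊑′ u₂ → u₂ ⊑′ u₃ → u₁ ⊑′ u₃
  ⊑′-trans u₁⊑u₂ (resp u≋u′ v≋v′ u⊑v) =
    resp ≋-refl v≋v′ (⊑′-trans (resp ≋-refl (≋-sym u≋u′) u₁⊑u₂) u⊑v)
  ⊑′-trans u₁⊑u₂ (rule1 {x} C x⊑y) with ⊑′-conNF⁻ C x u₁⊑u₂ ≋-refl
  ... | z , u₁≋Cz , z⊑x = resp (≋-sym u₁≋Cz) ≋-refl (rule1 C (⊑′-trans z⊑x x⊑y))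
  ⊑′-trans u₁⊑u₂ (rule2 {xs} xs⊑ys) with empty-or-inhabited (tupNF xs)
  ... | inj₁ xs⊆[] = resp (≋-empty xs⊆[] (⊑ᵃ-empty (⊑′⇒⊑ᵃ u₁⊑u₂) xs⊆[])) ≋-refl (rule2 xs⊑ys)
  ... | inj₂ (_ , t∈) with ⊑′-tupNF⁻ xs u₁⊑u₂ ≋-refl t∈
  ... | zs , u₁≋zs , zs⊑xs = resp (≋-sym u₁≋zs) ≋-refl (rule2 (pointwise-⊑′-trans zs⊑xs xs⊑ys))
  ⊑′-trans u₁⊑u₂ (rule3 {u} {v} w u⊑v) = ⊑′-trans-nfWt w v u₁⊑u₂ (rule3 {u} {v} w u⊑v)
  ⊑′-trans u₁⊑u₂ (rule4 as bs dom)      = ⊑′-trans-map-atom bs u₁⊑u₂ (rule4 as bs dom)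
  ⊑′-trans u₁⊑u₂ (rule5 {d} w w′ d⊑b h) = ⊑′-trans-map-atom ((w , d) ∷ []) u₁⊑u₂ (rule5 w w′ d⊑b h)
  ⊑′-trans u₁⊑u₂ (rule6 _)              = u₁⊑u₂

  pointwise-⊑′-trans : ∀ {zs xs ys} → Pointwise _⊑′_ zs xs → Pointwise _⊑′_ xs ys →
                       Pointwise _⊑′_ zs ys
  pointwise-⊑′-trans []             []             = []
  pointwise-⊑′-trans (z⊑x ∷ zs⊑xs) (x⊑y ∷ xs⊑ys) = ⊑′-trans z⊑x x⊑y ∷ pointwise-⊑′-trans zs⊑xs xs⊑ys

lemmaA3 : (u₁ u₂ u₃ : NF) → u₁ ⊑′ u₂ → u₂ ⊑′ u₃ → u₁ ⊑′ u₃
lemmaA3 _ _ _ = ⊑′-trans
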